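{- If a $\lambda\mu$-object $o$ is strongly normalizing for $\lambda\mu$-reduction, then $o$ is typable in system $\mathcal{S}_{\lambda\mu}$, i.e. some judgment $\Gamma\vdash o:\mathcal{A}\mid\Delta$ is derivable.
   Context: The $\lambda\mu$-calculus: terms $t,u::=x\mid\lambda x.t\mid t\,u\mid\mu\alpha.c$, commands $c::=[\alpha]t$, objects $o::=t\mid c$ ($x$ variables, $\alpha$ names); $\lambda x$ binds $x$, $\mu\alpha$ binds $\alpha$; objects up to renaming of bound symbols. $o\{x/u\}$: capture-avoiding substitution. Replacement $o\{\alpha/\!\!/u\}$: $x\{\alpha/\!\!/u\}=x$, homomorphic on abstraction, application and $\mu\gamma$, $([\gamma]t)\{\alpha/\!\!/u\}=[\gamma](t\{\alpha/\!\!/u\})$ for $\gamma\neq\alpha$, $([\alpha]t)\{\alpha/\!\!/u\}=[\alpha]((t\{\alpha/\!\!/u\})\,u)$. Reduction $\to$ is the closure under all contexts of $(\lambda x.t)u\to t\{x/u\}$ and $(\mu\alpha.c)u\to\mu\alpha.(c\{\alpha/\!\!/u\})$. Strongly normalizing: no infinite reduction sequence. Types: base types $a$; $\sigma::=a\mid\mathcal{I}\Rightarrow\mathcal{U}$; union types $\mathcal{U}=\langle\sigma_k\rangle_{k\in K}$ (finite multisets of types); intersection types $\mathcal{I}=[\mathcal{U}_k]_{k\in K}$ (finite multisets of union types); object types $\mathcal{A}$ are union types or $\#$. Blind types $\xi::=a\mid[\,]\Rightarrow\langle\xi\rangle$. $\wedge,\vee$ = multiset union. Choice: $\mathcal{I}^{*}=\mathcal{I}$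 if $\mathcal{I}\neq[\,]$, $[\,]^{*}=[\mathcal{U}]$ for an arbitrary non-empty $\mathcal{U}$; $\mathcal{U}^{*}=\mathcal{U}$ if $\mathcal{U}\neq\langle\,\rangle$, $\langle\,\rangle^{*}=\langle\xi\rangle$ for an arbitrary blind $\xi$. Variable assignments $\Gamma$ (to intersection types), name assignments $\Delta$ (to union types), domains = elements with non-empty image; $\wedge,\vee$ pointwise; $\Gamma\setminus x$, $\Delta\setminus\alpha$ empty an entry. System $\mathcal{S}_{\lambda\mu}$: (ax) $x:[\mathcal{U}]\vdash x:\mathcal{U}\mid\emptyset$ if $\mathcal{U}\neq\langle\,\rangle$; ($\Rightarrow_i$) from $\Gamma\vdash t:\mathcal{U}\mid\Delta$ infer $\Gamma\setminus x\vdash\lambda x.t:\langle\Gamma(x)\Rightarrow\mathcal{U}\rangle\mid\Delta$; ($\#_i$) from $\Gamma\vdash t:\mathcal{U}\mid\Delta$ infer $\Gamma\vdash[\alpha]t:\#\mid\Delta\vee\{\alpha:\mathcal{U}\}$; ($\#_e$) from $\Gamma\vdash c:\#\mid\Delta$ infer $\Gamma\vdash\mu\alpha.c:(\Delta(\alpha))^{*}\mid\Delta\setminus\alpha$; ($\wedge$) from $(\Gamma_k\vdash t:\mathcal{U}_k\mid\Delta_k)_{k\in K}$ infer $\wedge_k\Gamma_k\Vdash t:[\mathcal{U}_k]_{k\in K}\mid\vee_k\Delta_k$; ($\Rightarrow_{e*}$) from $\Gamma_t\vdash t:\langle\mathcal{I}_k\Rightarrow\mathcal{U}_k\rangle_{k\in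 K}\mid\Delta_t$ and $\Gamma_u\Vdash u:\wedge_k(\mathcal{I}_k)^{*}\mid\Delta_u$ infer $\Gamma_t\wedge\Gamma_u\vdash t\,u:\vee_k\mathcal{U}_k\mid\Delta_t\vee\Delta_u$. -}

module Defs where

open import Data.Nat using (ℕ; zero; suc; _≟_)
open import Data.List using (List; []; _∷_; _++_; map; concat)
open import Data.Product using (_×_; proj₁; proj₂)
open import Relation.Nullary using (yes; no)
open import Data.List.Relation.Binary.Pointwise using (Pointwise)
open import Data.List.Relation.Binary.Permutation.Homogeneous using (Permutation)
open import Induction.WellFounded using (Acc)

-- λμ-syntax, locally nameless à la de Bruijn (bound symbols up to
-- renaming).  Variables and names live in two independent index
-- spaces: λ binds variable 0, μ binds name 0.

mutual
  data Term : Set where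
    var : ℕ → Term
    lam : Term → Term
    app : Term → Term → Term
    mu  : Cmd → Term

  data Cmd : Set where
    cmd : ℕ → Term → Cmd

data Obj : Set where
  term : Term → Obj
  com  : Cmd → Obj

ext : (ℕ → ℕ) → ℕ → ℕ
ext ρ zero    = zero
ext ρ (suc n) = suc (ρ n)

mutual
  renV : (ℕ → ℕ) → Term → Term
  renV ρ (var x)   = var (ρ x)
  renV ρ (lam t)   = lam (renV (ext ρ) t)
  renV ρ (app t u) = app (renV ρ t) (renV ρ u)
  renV ρ (mu c)    = mu (renVc ρ c)

  renVc : (ℕ → ℕ) → Cmd → Cmd
  renVc ρ (cmd α t) = cmd α (renV ρ t)

mutual
  renN : (ℕ → ℕ) → Term → Term
  renN ρ (var x)   = var x
  renN ρ (lam t)   = lam (renN ρ t)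
  renN ρ (app t u) = app (renN ρ t) (renN ρ u)
  renN ρ (mu c)    = mu (renNc (ext ρ) c)

  renNc : (ℕ → ℕ) → Cmd → Cmd
  renNc ρ (cmd α t) = cmd (ρ α) (renN ρ t)

extsV : (ℕ → Term) → ℕ → Term
extsV σ zero    = var zero
extsV σ (suc n) = renV suc (σ n)

mutual
  subV : (ℕ → Term) → Term → Term
  subV σ (var x)   = σ x
  subV σ (lam t)   = lam (subV (extsV σ) t)
  subV σ (app t u) = app (subV σ t) (subV σ u)
  subV σ (mu c)    = mu (subVc (λ n → renN suc (σ n)) c)

  subVc : (ℕ → Term) → Cmd → Cmd
  subVc σ (cmd α t) = cmd α (subV σ t)

single-sub : Term → ℕ → Term
single-sub u zero    = u
single-sub u (suc n) = var n

-- t{x/u} where x is the variable bound by the enclosing λ (index 0)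
_[_] : Term → Term → Term
t [ u ] = subV (single-sub u) t

mutual
  repl : ℕ → Term → Term → Term
  repl α u (var x)   = var x
  repl α u (lam t)   = lam (repl α (renV suc u) t)
  repl α u (app t v) = app (repl α u t) (repl α u v)
  repl α u (mu c)    = mu (replc (suc α) (renN suc u) c)

  replc : ℕ → Term → Cmd → Cmd
  replc α u (cmd γ t) with γ ≟ α
  ... | yes _ = cmd γ (app (repl α u t) u)
  ... | no _  = cmd γ (repl α u t)

mutual
  data _→t_ : Term → Term → Set where
    β     : ∀ {t u} → app (lam t) u →t (t [ u ])
    μ     : ∀ {c u} → app (mu c) u →t mu (replc zero (renN suc u) c)
    lamC  : ∀ {t t'} → t →t t' → lam t →t lam t'
    appL  : ∀ {t t' u} → t →t t' → app t u →t app t' u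
    appR  : ∀ {t u u'} → u →t u' → app t u →t app t u'
    muC   : ∀ {c c'} → c →c c' → mu c →t mu c'

  data _→c_ : Cmd → Cmd → Set where
    cmdC  : ∀ {α t t'} → t →t t' → cmd α t →c cmd α t'

data _⟶_ : Obj → Obj → Set where
  term : ∀ {t t'} → t →t t' → term t ⟶ term t'
  com  : ∀ {c c'} → c →c c' → com c ⟶ com c'

SN : Obj → Set
SN = Acc (λ o' o → o ⟶ o')

-- Types.  Multisets are represented by lists, compared up to
-- (nested) permutation.

data Ty : Set where
  base : ℕ → Ty
  _⇒_  : List (List Ty) → List Ty → Ty

Union : Set
Union = List Ty

Inter : Set
Inter = List Union

data _≈T_ : Ty → Ty → Set where
  base : ∀ {a} → base a ≈T base a
  arr  : ∀ {I I' U U'} → Permutation (Permutation _≈T_) I I' →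
         Permutation _≈T_ U U' → (I ⇒ U) ≈T (I' ⇒ U')

_≈I_ : Inter → Inter → Set
_≈I_ = Permutation (Permutation _≈T_)

data Blind : Ty → Set where
  base : ∀ {a} → Blind (base a)
  arr  : ∀ {ξ} → Blind ξ → Blind ([] ⇒ (ξ ∷ []))

-- the choice operators, as relations (the choice is arbitrary)
data _⋆I_ : Inter → Inter → Set where
  keep   : ∀ {U I} → (U ∷ I) ⋆I (U ∷ I)
  choose : ∀ {σ U} → [] ⋆I ((σ ∷ U) ∷ [])

data _⋆U_ : Union → Union → Set where
  keep   : ∀ {σ U} → (σ ∷ U) ⋆U (σ ∷ U)
  choose : ∀ {ξ} → Blind ξ → [] ⋆U (ξ ∷ [])

data OType : Set where
  union : Union → OType
  #     : OType

-- assignments (domain = indices with non-empty image)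
VarCtx : Set
VarCtx = ℕ → Inter

NameCtx : Set
NameCtx = ℕ → Union

∅V : VarCtx
∅V _ = []

∅N : NameCtx
∅N _ = []

_∧_ : VarCtx → VarCtx → VarCtx
(Γ ∧ Γ') n = Γ n ++ Γ' n

_∨_ : NameCtx → NameCtx → NameCtx
(Δ ∨ Δ') n = Δ n ++ Δ' n

singleV : ℕ → Inter → VarCtx
singleV zero    I zero    = I
singleV zero    I (suc m) = []
singleV (suc n) I zero    = []
singleV (suc n) I (suc m) = singleV n I m

singleN : ℕ → Union → NameCtx
singleN zero    U zero    = U
singleN zero    U (suc m) = []
singleN (suc n) U zero    = []
singleN (suc n) U (suc m) = singleN n U m

arrow : Inter × Union → Ty
arrow p = proj₁ p ⇒ proj₂ p

mutual
  data _⊢_∶_∣_ : VarCtx → Term → Union → NameCtx → Set where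
    ax  : ∀ x σ U → singleV x ((σ ∷ U) ∷ []) ⊢ var x ∶ (σ ∷ U) ∣ ∅N
    ⇒i  : ∀ {Γ t U Δ} → Γ ⊢ t ∶ U ∣ Δ →
          (λ n → Γ (suc n)) ⊢ lam t ∶ ((Γ zero ⇒ U) ∷ []) ∣ Δ
    #e  : ∀ {Γ c Δ V} → Γ ⊢c c ∣ Δ → Δ zero ⋆U V →
          Γ ⊢ mu c ∶ V ∣ (λ n → Δ (suc n))
    ⇒e* : ∀ {Γt Γu t u Δt Δu J Is} (ps : List (Inter × Union)) →
          Γt ⊢ t ∶ map arrow ps ∣ Δt →
          Γu ⊩ u ∶ J ∣ Δu →
          Pointwise _⋆I_ (map proj₁ ps) Is →
          J ≈I concat Is →
          (Γt ∧ Γu) ⊢ app t u ∶ concat (map proj₂ ps) ∣ (Δt ∨ Δu)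

  data _⊢c_∣_ : VarCtx → Cmd → NameCtx → Set where
    #i : ∀ {Γ t U Δ} α → Γ ⊢ t ∶ U ∣ Δ → Γ ⊢c cmd α t ∣ (Δ ∨ singleN α U)

  data _⊩_∶_∣_ : VarCtx → Term → Inter → NameCtx → Set where
    []  : ∀ {t} → ∅V ⊩ t ∶ [] ∣ ∅N
    _∷_ : ∀ {Γ Γ' t U I Δ Δ'} → Γ ⊢ t ∶ U ∣ Δ → Γ' ⊩ t ∶ I ∣ Δ' →
          (Γ ∧ Γ') ⊩ t ∶ (U ∷ I) ∣ (Δ ∨ Δ')

data _⊢o_∶_∣_ : VarCtx → Obj → OType → NameCtx → Set where
  term : ∀ {Γ t U Δ} → Γ ⊢ t ∶ U ∣ Δ → Γ ⊢o term t ∶ union U ∣ Δ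
  com  : ∀ {Γ c Δ} → Γ ⊢c c ∣ Δ → Γ ⊢o com c ∶ # ∣ Δ

module Submission where

-- We work in a subsystem ⊢⁺ of S_λμ in which every union type is non-empty
-- and in (⇒e*) the argument is typed at exactly the chosen intersection
-- ∧ₖ Iₖ*; every ⊢⁺-derivation is an S_λμ-derivation (forget).
--
-- The core is subject expansion for head reductions: if the reduct of a
-- head redex (λx.t)u or (μα.c)u is typable, and u is typable, then so is
-- the redex, with the same type.  For β this is anti-substitution: a
-- typing of t{x/u} splits into a typing of t and typings of u at the types
-- assumed for x.  For μ it is anti-replacement: a typing of c{α//u} gives a
-- typing of c in which α has type ⟨Iₖ ⇒ Uₖ⟩ₖ, while it had ∨ₖ Uₖ in c{α//u},
-- together with a typing of u at ∧ₖ Iₖ*.  Both lemmas go under binders,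
-- hence are proved for shifted copies of u, which relies on the inversion
-- of typings along injective renamings.
--
-- Finally every subterm t of an SN object o is typable, by induction on the
-- accessibility proof of o and, for fixed o, on t.  An application is
-- either neutral (its head is a variable, and it is typable at every
-- non-empty type) or contains a head redex; the reduct of the latter occurs
-- in a reduct of o, so it is typable by the outer induction, and subject
-- expansion transfers the typing back.

open import Defs
open import Data.Nat using (ℕ; zero; suc; _≟_; _<_; z≤n; s≤s; pred)
open import Data.Nat.Properties
  using (<-cmp; <-trans; <-≤-trans; <⇒≢; <⇒≤pred; >⇒≢; ≤-refl; n<1+n; suc-injective)
open import Data.List using (List; []; _∷_; _++_; map; concat)
open import Data.List.Properties using (++-identityʳ; map-++; concat-++)
open import Data.List.Relation.Unary.All using (All; []; _∷_)
import Data.List.Relation.Unary.All.Properties as All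
open import Data.List.Relation.Binary.Pointwise using (Pointwise; []; _∷_)
import Data.List.Relation.Binary.Pointwise as Pointwise
open import Data.List.Relation.Binary.Permutation.Homogeneous using (Permutation; refl)
open import Data.Product using (Σ; ∃; _×_; _,_; proj₁; proj₂)
open import Data.Unit using (⊤; tt)
open import Data.Empty using (⊥; ⊥-elim)
open import Relation.Nullary using (yes; no)
open import Relation.Binary using (tri<; tri≈; tri>)
open import Relation.Binary.PropositionalEquality hiding ([_])
open import Function.Definitions using (Injective)
open import Induction.WellFounded using (acc)

NonEmpty : {A : Set} → List A → Set
NonEmpty []      = ⊥
NonEmpty (_ ∷ _) = ⊤

++-nonempty : {A : Set} {xs ys : List A} → NonEmpty xs → NonEmpty (xs ++ ys)
++-nonempty {xs = _ ∷ _} _ = tt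

++-≡[] : {A : Set} (xs : List A) {ys : List A} → ys ≡ [] → xs ++ ys ≡ xs
++-≡[] xs refl = ++-identityʳ xs

mutual
  data _⊢⁺_∶_∣_ : VarCtx → Term → Union → NameCtx → Set where
    ax  : ∀ x σ U → singleV x ((σ ∷ U) ∷ []) ⊢⁺ var x ∶ (σ ∷ U) ∣ ∅N
    ⇒i  : ∀ {Γ t U Δ} → Γ ⊢⁺ t ∶ U ∣ Δ →
          (λ n → Γ (suc n)) ⊢⁺ lam t ∶ ((Γ zero ⇒ U) ∷ []) ∣ Δ
    #e  : ∀ {Γ c Δ V} → Γ ⊢c⁺ c ∣ Δ → Δ zero ⋆U V →
          Γ ⊢⁺ mu c ∶ V ∣ (λ n → Δ (suc n))
    ⇒e* : ∀ {Γt Γu t u Δt Δu Is} (ps : List (Inter × Union)) →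
          Γt ⊢⁺ t ∶ map arrow ps ∣ Δt →
          Γu ⊩⁺ u ∶ concat Is ∣ Δu →
          Pointwise _⋆I_ (map proj₁ ps) Is →
          All NonEmpty (map proj₂ ps) →
          (Γt ∧ Γu) ⊢⁺ app t u ∶ concat (map proj₂ ps) ∣ (Δt ∨ Δu)

  data _⊢c⁺_∣_ : VarCtx → Cmd → NameCtx → Set where
    #i : ∀ {Γ t U Δ} α → Γ ⊢⁺ t ∶ U ∣ Δ → Γ ⊢c⁺ cmd α t ∣ (Δ ∨ singleN α U)

  data _⊩⁺_∶_∣_ : VarCtx → Term → Inter → NameCtx → Set where
    []  : ∀ {t} → ∅V ⊩⁺ t ∶ [] ∣ ∅N
    _∷_ : ∀ {Γ Γ' t U I Δ Δ'} → Γ ⊢⁺ t ∶ U ∣ Δ → Γ' ⊩⁺ t ∶ I ∣ Δ' →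
          (Γ ∧ Γ') ⊩⁺ t ∶ (U ∷ I) ∣ (Δ ∨ Δ')

mutual
  ≈T-refl : ∀ σ → σ ≈T σ
  ≈T-refl (base a) = base
  ≈T-refl (I ⇒ U)  = arr (refl (inter-pointwise-refl I)) (refl (union-pointwise-refl U))

  union-pointwise-refl : ∀ U → Pointwise _≈T_ U U
  union-pointwise-refl []      = []
  union-pointwise-refl (σ ∷ U) = ≈T-refl σ ∷ union-pointwise-refl U

  inter-pointwise-refl : ∀ I → Pointwise (Permutation _≈T_) I I
  inter-pointwise-refl []      = []
  inter-pointwise-refl (U ∷ I) = refl (union-pointwise-refl U) ∷ inter-pointwise-refl I

mutual
  forget : ∀ {Γ t U Δ} → Γ ⊢⁺ t ∶ U ∣ Δ → Γ ⊢ t ∶ U ∣ Δ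
  forget (ax x σ U)  = ax x σ U
  forget (⇒i D)      = ⇒i (forget D)
  forget (#e D s)    = #e (forget-cmd D) s
  forget (⇒e* {Is = Is} ps D E choices _) =
    ⇒e* ps (forget D) (forget-∧ E) choices (refl (inter-pointwise-refl (concat Is)))

  forget-cmd : ∀ {Γ c Δ} → Γ ⊢c⁺ c ∣ Δ → Γ ⊢c c ∣ Δ
  forget-cmd (#i α D) = #i α (forget D)

  forget-∧ : ∀ {Γ t I Δ} → Γ ⊩⁺ t ∶ I ∣ Δ → Γ ⊩ t ∶ I ∣ Δ
  forget-∧ []      = []
  forget-∧ (D ∷ E) = forget D ∷ forget-∧ E

⋆U-nonempty : ∀ {L V} → L ⋆U V → NonEmpty V
⋆U-nonempty keep       = tt
⋆U-nonempty (choose _) = tt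

⋆U-keeps : ∀ {L V} → L ⋆U V → NonEmpty L → V ≡ L
⋆U-keeps keep _ = refl

⋆U-blind : ∀ {V} → [] ⋆U V → Σ Ty λ ξ → Blind ξ × V ≡ ξ ∷ []
⋆U-blind (choose b) = _ , b , refl

typed-nonempty : ∀ {Γ t U Δ} → Γ ⊢⁺ t ∶ U ∣ Δ → NonEmpty U
typed-nonempty (ax x σ U) = tt
typed-nonempty (⇒i D)     = tt
typed-nonempty (#e D s)   = ⋆U-nonempty s
typed-nonempty (⇒e* [] D E _ _)                        = ⊥-elim (typed-nonempty D)
typed-nonempty (⇒e* ((I , []) ∷ ps) D E _ (() ∷ _))
typed-nonempty (⇒e* ((I , (σ ∷ U)) ∷ ps) D E _ _)     = tt

-- Some derivation of J exists; the theorem only asks for some Γ and Δ, so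
-- typings are mostly carried around with their contexts left existential.
record Derivable (J : VarCtx → NameCtx → Set) : Set where
  constructor derivable
  field
    {Γ}        : VarCtx
    {Δ}        : NameCtx
    derivation : J Γ Δ

Typable : Term → Union → Set
Typable t U = Derivable (λ Γ Δ → Γ ⊢⁺ t ∶ U ∣ Δ)

Typable∧ : Term → Inter → Set
Typable∧ t I = Derivable (λ Γ Δ → Γ ⊩⁺ t ∶ I ∣ Δ)

Typed : Term → Set
Typed t = Σ Union (Typable t)

retype : ∀ {t U V} → U ≡ V → Typable t U → Typable t V
retype refl T = T

retype∧ : ∀ {t I J} → I ≡ J → Typable∧ t I → Typable∧ t J
retype∧ refl T = T

Typable∧-++ : ∀ {t I J} → Typable∧ t I → Typable∧ t J → Typable∧ t (I ++ J)
Typable∧-++ (derivable []) T = T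
Typable∧-++ (derivable (D ∷ E)) T with Typable∧-++ (derivable E) T
... | derivable F = derivable (D ∷ F)

ax⁺ : ∀ x U → NonEmpty U → singleV x (U ∷ []) ⊢⁺ var x ∶ U ∣ ∅N
ax⁺ x (σ ∷ U) _ = ax x σ U

var-inversion : ∀ {Γ x U Δ} → Γ ⊢⁺ var x ∶ U ∣ Δ → (Γ ≗ singleV x (U ∷ [])) × (Δ ≗ ∅N)
var-inversion (ax x σ U) = (λ _ → refl) , (λ _ → refl)

typable-app : ∀ {Γ t u Δ I I* U} → Γ ⊢⁺ t ∶ ((I ⇒ U) ∷ []) ∣ Δ → NonEmpty U →
              I ⋆I I* → Typable∧ u I* → Typable (app t u) U
typable-app {I* = I*} {U} D neU choice Tu with retype∧ (sym (++-identityʳ I*)) Tu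
... | derivable E = retype (++-identityʳ U) (derivable (⇒e* ((_ , U) ∷ []) D E (choice ∷ []) (neU ∷ [])))

choose-argument : ∀ {u} I → Typable∧ u I → Typed u → Σ Inter λ I* → (I ⋆I I*) × Typable∧ u I*
choose-argument (U ∷ I) Tu _ = (U ∷ I) , keep , Tu
choose-argument [] _ ((σ ∷ U) , derivable D) = ((σ ∷ U) ∷ []) , choose , derivable (D ∷ [])
choose-argument [] _ ([] , derivable D)      = ⊥-elim (typed-nonempty D)

singleV-at : ∀ n I → singleV n I n ≡ I
singleV-at zero    I = refl
singleV-at (suc n) I = singleV-at n I

singleV-off : ∀ n m I → n ≢ m → singleV n I m ≡ []
singleV-off zero    zero    I n≢m = ⊥-elim (n≢m refl)
singleV-off zero    (suc m) I n≢m = refl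
singleV-off (suc n) zero    I n≢m = refl
singleV-off (suc n) (suc m) I n≢m = singleV-off n m I (λ e → n≢m (cong suc e))

singleN-at : ∀ n U → singleN n U n ≡ U
singleN-at zero    U = refl
singleN-at (suc n) U = singleN-at n U

singleN-off : ∀ n m U → n ≢ m → singleN n U m ≡ []
singleN-off zero    zero    U n≢m = ⊥-elim (n≢m refl)
singleN-off zero    (suc m) U n≢m = refl
singleN-off (suc n) zero    U n≢m = refl
singleN-off (suc n) (suc m) U n≢m = singleN-off n m U (λ e → n≢m (cong suc e))

singleV-rename : ∀ ρ → Injective _≡_ _≡_ ρ → ∀ x n I → singleV x I n ≡ singleV (ρ x) I (ρ n)
singleV-rename ρ inj x n I with x ≟ n
... | yes refl = trans (singleV-at x I) (sym (singleV-at (ρ x) I))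
... | no x≢n   = trans (singleV-off x n I x≢n) (sym (singleV-off (ρ x) (ρ n) I (λ e → x≢n (inj e))))

singleN-rename : ∀ ρ → Injective _≡_ _≡_ ρ → ∀ α n U → singleN α U n ≡ singleN (ρ α) U (ρ n)
singleN-rename ρ inj α n U with α ≟ n
... | yes refl = trans (singleN-at α U) (sym (singleN-at (ρ α) U))
... | no α≢n   = trans (singleN-off α n U α≢n) (sym (singleN-off (ρ α) (ρ n) U (λ e → α≢n (inj e))))

ext-injective : ∀ {ρ} → Injective _≡_ _≡_ ρ → Injective _≡_ _≡_ (ext ρ)
ext-injective inj {zero}  {zero}  e = refl
ext-injective inj {suc a} {suc b} e = cong suc (inj (suc-injective e))

ext-off-range : ∀ {ρ m} → (∀ n → ρ n ≢ m) → ∀ n → ext ρ n ≢ suc m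
ext-off-range off zero    ()
ext-off-range off (suc n) e = off n (suc-injective e)

_≐_below_ : {A : Set} → (ℕ → List A) → (ℕ → List A) → ℕ → Set
f ≐ g below k = ∀ m → m < k → f m ≡ g m

≐-++ : {A : Set} {f f' g g' : ℕ → List A} {k : ℕ} → f ≐ f' below k → g ≐ g' below k →
       (λ n → f n ++ g n) ≐ (λ n → f' n ++ g' n) below k
≐-++ e e' m lt = cong₂ _++_ (e m lt) (e' m lt)

record VarRenamingInv (J : VarCtx → NameCtx → Set) (ρ : ℕ → ℕ) (Γ : VarCtx) (Δ : NameCtx) : Set where
  constructor unrenamedV
  field
    {Γ'}       : VarCtx
    derivation : J Γ' Δ
    pulled     : Γ' ≗ (λ n → Γ (ρ n))
    off-range  : ∀ m → (∀ n → ρ n ≢ m) → Γ m ≡ []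

mutual
  renV-inversion : ∀ ρ → Injective _≡_ _≡_ ρ → ∀ t {Γ U Δ} → Γ ⊢⁺ renV ρ t ∶ U ∣ Δ →
                   VarRenamingInv (λ G D → G ⊢⁺ t ∶ U ∣ D) ρ Γ Δ
  renV-inversion ρ inj (var x) (ax .(ρ x) σ U) =
    unrenamedV (ax x σ U) (λ n → singleV-rename ρ inj x n _) (λ m off → singleV-off (ρ x) m _ (off x))
  renV-inversion ρ inj (lam s) (⇒i {U = U} D) with renV-inversion (ext ρ) (ext-injective inj) s D
  ... | unrenamedV {Γ'} d e off =
    unrenamedV (subst (λ I → (λ k → Γ' (suc k)) ⊢⁺ lam s ∶ ((I ⇒ U) ∷ []) ∣ _) (e zero) (⇒i d))
               (λ k → e (suc k)) (λ m off' → off (suc m) (ext-off-range off'))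
  renV-inversion ρ inj (app t u) (⇒e* ps D E choices ne)
    with renV-inversion ρ inj t D | renV-inversion-∧ ρ inj u E
  ... | unrenamedV d e off | unrenamedV d' e' off' =
    unrenamedV (⇒e* ps d d' choices ne) (λ k → cong₂ _++_ (e k) (e' k))
               (λ m h → cong₂ _++_ (off m h) (off' m h))
  renV-inversion ρ inj (mu c) (#e D s) with renV-inversion-cmd ρ inj c D
  ... | unrenamedV d e off = unrenamedV (#e d s) e off

  renV-inversion-cmd : ∀ ρ → Injective _≡_ _≡_ ρ → ∀ c {Γ Δ} → Γ ⊢c⁺ renVc ρ c ∣ Δ →
                       VarRenamingInv (λ G D → G ⊢c⁺ c ∣ D) ρ Γ Δ
  renV-inversion-cmd ρ inj (cmd α t) (#i .α D) with renV-inversion ρ inj t D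
  ... | unrenamedV d e off = unrenamedV (#i α d) e off

  renV-inversion-∧ : ∀ ρ → Injective _≡_ _≡_ ρ → ∀ t {Γ I Δ} → Γ ⊩⁺ renV ρ t ∶ I ∣ Δ →
                     VarRenamingInv (λ G D → G ⊩⁺ t ∶ I ∣ D) ρ Γ Δ
  renV-inversion-∧ ρ inj t [] = unrenamedV [] (λ _ → refl) (λ _ _ → refl)
  renV-inversion-∧ ρ inj t (D ∷ E) with renV-inversion ρ inj t D | renV-inversion-∧ ρ inj t E
  ... | unrenamedV d e off | unrenamedV d' e' off' =
    unrenamedV (d ∷ d') (λ k → cong₂ _++_ (e k) (e' k)) (λ m h → cong₂ _++_ (off m h) (off' m h))

record NameRenamingInv (J : VarCtx → NameCtx → Set) (ρ : ℕ → ℕ) (Γ : VarCtx) (Δ : NameCtx) : Set where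
  constructor unrenamedN
  field
    {Δ'}       : NameCtx
    derivation : J Γ Δ'
    pulled     : Δ' ≗ (λ n → Δ (ρ n))
    off-range  : ∀ m → (∀ n → ρ n ≢ m) → Δ m ≡ []

mutual
  renN-inversion : ∀ ρ → Injective _≡_ _≡_ ρ → ∀ t {Γ U Δ} → Γ ⊢⁺ renN ρ t ∶ U ∣ Δ →
                   NameRenamingInv (λ G D → G ⊢⁺ t ∶ U ∣ D) ρ Γ Δ
  renN-inversion ρ inj (var x) (ax .x σ U) = unrenamedN (ax x σ U) (λ _ → refl) (λ _ _ → refl)
  renN-inversion ρ inj (lam s) (⇒i D) with renN-inversion ρ inj s D
  ... | unrenamedN d e off = unrenamedN (⇒i d) e off
  renN-inversion ρ inj (app t u) (⇒e* ps D E choices ne)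
    with renN-inversion ρ inj t D | renN-inversion-∧ ρ inj u E
  ... | unrenamedN d e off | unrenamedN d' e' off' =
    unrenamedN (⇒e* ps d d' choices ne) (λ b → cong₂ _++_ (e b) (e' b))
               (λ m h → cong₂ _++_ (off m h) (off' m h))
  renN-inversion ρ inj (mu c) (#e {V = V} D s) with renN-inversion-cmd (ext ρ) (ext-injective inj) c D
  ... | unrenamedN d e off =
    unrenamedN (#e d (subst (_⋆U V) (sym (e zero)) s)) (λ b → e (suc b))
               (λ m off' → off (suc m) (ext-off-range off'))

  renN-inversion-cmd : ∀ ρ → Injective _≡_ _≡_ ρ → ∀ c {Γ Δ} → Γ ⊢c⁺ renNc ρ c ∣ Δ →
                       NameRenamingInv (λ G D → G ⊢c⁺ c ∣ D) ρ Γ Δ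
  renN-inversion-cmd ρ inj (cmd α t) (#i {U = U} .(ρ α) D) with renN-inversion ρ inj t D
  ... | unrenamedN d e off =
    unrenamedN (#i α d) (λ b → cong₂ _++_ (e b) (singleN-rename ρ inj α b U))
               (λ m off' → cong₂ _++_ (off m off') (singleN-off (ρ α) m U (off' α)))

  renN-inversion-∧ : ∀ ρ → Injective _≡_ _≡_ ρ → ∀ t {Γ I Δ} → Γ ⊩⁺ renN ρ t ∶ I ∣ Δ →
                     NameRenamingInv (λ G D → G ⊩⁺ t ∶ I ∣ D) ρ Γ Δ
  renN-inversion-∧ ρ inj t [] = unrenamedN [] (λ _ → refl) (λ _ _ → refl)
  renN-inversion-∧ ρ inj t (D ∷ E) with renN-inversion ρ inj t D | renN-inversion-∧ ρ inj t E
  ... | unrenamedN d e off | unrenamedN d' e' off' =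
    unrenamedN (d ∷ d') (λ b → cong₂ _++_ (e b) (e' b)) (λ m h → cong₂ _++_ (off m h) (off' m h))

-- Shifted u k j w: w is u with its free variables shifted by k and its
-- free names shifted by j (the form u takes under k λ's and j μ's).
data Shifted (u : Term) : ℕ → ℕ → Term → Set where
  unshifted : Shifted u 0 0 u
  shiftV    : ∀ {k j w} → Shifted u k j w → Shifted u (suc k) j (renV suc w)
  shiftN    : ∀ {k j w} → Shifted u k j w → Shifted u k (suc j) (renN suc w)

record ShiftInv (J : VarCtx → NameCtx → Set) (k j : ℕ) (Γ : VarCtx) (Δ : NameCtx) : Set where
  constructor unshiftedBy
  field
    original      : Derivable J
    vanishing-var : (λ _ → []) ≐ Γ below k
    vanishing-nam : (λ _ → []) ≐ Δ below j

shift-inversion : ∀ {u k j w Γ U Δ} → Shifted u k j w → Γ ⊢⁺ w ∶ U ∣ Δ →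
                  ShiftInv (λ G D → G ⊢⁺ u ∶ U ∣ D) k j Γ Δ
shift-inversion unshifted D = unshiftedBy (derivable D) (λ _ ()) (λ _ ())
shift-inversion (shiftV {w = w} sh) D with renV-inversion suc suc-injective w D
... | unrenamedV d e off with shift-inversion sh d
... | unshiftedBy T vΓ vΔ = unshiftedBy T vanish vΔ
  where
  vanish : (λ _ → []) ≐ _ below _
  vanish zero    _         = sym (off zero (λ _ ()))
  vanish (suc m) (s≤s lt) = trans (vΓ m lt) (e m)
shift-inversion (shiftN {w = w} sh) D with renN-inversion suc suc-injective w D
... | unrenamedN d e off with shift-inversion sh d
... | unshiftedBy T vΓ vΔ = unshiftedBy T vΓ vanish
  where
  vanish : (λ _ → []) ≐ _ below _
  vanish zero    _         = sym (off zero (λ _ ()))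
  vanish (suc b) (s≤s lt) = trans (vΔ b lt) (e b)

shift-inversion-∧ : ∀ {u k j w Γ I Δ} → Shifted u k j w → Γ ⊩⁺ w ∶ I ∣ Δ →
                    ShiftInv (λ G D → G ⊩⁺ u ∶ I ∣ D) k j Γ Δ
shift-inversion-∧ sh [] = unshiftedBy (derivable []) (λ _ _ → refl) (λ _ _ → refl)
shift-inversion-∧ sh (D ∷ E) with shift-inversion sh D | shift-inversion-∧ sh E
... | unshiftedBy (derivable d) vΓ vΔ | unshiftedBy (derivable d') vΓ' vΔ' =
  unshiftedBy (derivable (d ∷ d')) (≐-++ vΓ vΓ') (≐-++ vΔ vΔ')

-- σ is the substitution {x/u} seen under k λ's and j μ's: it replaces
-- variable k by a shifted copy of u, fixes the variables below k and
-- renumbers those above k.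
record SubstAt (u : Term) (k j : ℕ) (σ : ℕ → Term) : Set where
  constructor substAt
  field
    {w}     : Term
    shifted : Shifted u k j w
    at      : σ k ≡ w
    below   : ∀ m → m < k → σ m ≡ var m
    above   : ∀ m → k < m → σ m ≡ var (pred m)

SubstAt-top : ∀ u → SubstAt u 0 0 (single-sub u)
SubstAt-top u = substAt unshifted refl (λ _ ()) above
  where
  above : ∀ m → 0 < m → single-sub u m ≡ var (pred m)
  above (suc m) _ = refl

SubstAt-underλ : ∀ {u k j σ} → SubstAt u k j σ → SubstAt u (suc k) j (extsV σ)
SubstAt-underλ (substAt sh at below above) = substAt (shiftV sh) (cong (renV suc) at) below' above'
  where
  below' : ∀ m → m < suc _ → extsV _ m ≡ var m
  below' zero    _         = refl
  below' (suc m) (s≤s lt) = cong (renV suc) (below m lt)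
  above' : ∀ m → suc _ < m → extsV _ m ≡ var (pred m)
  above' (suc (suc m)) (s≤s lt) = cong (renV suc) (above (suc m) lt)

SubstAt-underμ : ∀ {u k j σ} → SubstAt u k j σ → SubstAt u k (suc j) (λ n → renN suc (σ n))
SubstAt-underμ (substAt sh at below above) =
  substAt (shiftN sh) (cong (renN suc) at) (λ m lt → cong (renN suc) (below m lt))
          (λ m lt → cong (renN suc) (above m lt))

record SubstInv (J : VarCtx → NameCtx → Set) (u : Term) (k j : ℕ) (Γ : VarCtx) (Δ : NameCtx) : Set where
  constructor unsubstituted
  field
    {Γ₀}       : VarCtx
    {Δ₀}       : NameCtx
    derivation : J Γ₀ Δ₀
    agree-var  : Γ₀ ≐ Γ below k
    agree-nam  : Δ₀ ≐ Δ below j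
    argument   : Typable∧ u (Γ₀ k)

-- A variable m other than k is mapped to a variable y: its typing is
-- rebuilt by (ax), and u is used at the empty intersection.
anti-substitution-var : ∀ {u k j σ m y Γ U Δ} → σ m ≡ var y → m ≢ k →
                        (λ n → singleV m (U ∷ []) n) ≐ (λ n → singleV y (U ∷ []) n) below k →
                        Γ ⊢⁺ subV σ (var m) ∶ U ∣ Δ → SubstInv (λ G D → G ⊢⁺ var m ∶ U ∣ D) u k j Γ Δ
anti-substitution-var {k = k} {m = m} {Γ = Γ} {U} {Δ} σm≡y m≢k agree D
  with var-inversion (subst (λ t → Γ ⊢⁺ t ∶ U ∣ Δ) σm≡y D)
... | Γ≗ , Δ≗ =
  unsubstituted (ax⁺ m U (typed-nonempty D)) (λ n n<k → trans (agree n n<k) (sym (Γ≗ n)))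
                (λ b _ → sym (Δ≗ b)) (retype∧ (sym (singleV-off m k _ m≢k)) (derivable []))

mutual
  anti-substitution : ∀ {u k j σ} → SubstAt u k j σ → ∀ t {Γ U Δ} → Γ ⊢⁺ subV σ t ∶ U ∣ Δ →
                      SubstInv (λ G D → G ⊢⁺ t ∶ U ∣ D) u k j Γ Δ
  anti-substitution {k = k} {σ = σ} (substAt sh at below above) (var m) {Γ} {U} {Δ} D with <-cmp m k
  ... | tri< m<k _ _ = anti-substitution-var {σ = σ} (below m m<k) (<⇒≢ m<k) (λ _ _ → refl) D
  ... | tri> _ _ k<m =
    anti-substitution-var {σ = σ} (above m k<m) (>⇒≢ k<m)
      (λ n n<k → trans (singleV-off m n _ (>⇒≢ (<-trans n<k k<m)))
                       (sym (singleV-off (pred m) n _ (>⇒≢ (<-≤-trans n<k (<⇒≤pred k<m)))))) D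
  ... | tri≈ _ refl _ with shift-inversion sh (subst (λ t → Γ ⊢⁺ t ∶ U ∣ Δ) at D)
  ... | unshiftedBy (derivable d) vΓ vΔ =
    unsubstituted (ax⁺ m U (typed-nonempty D))
                  (λ n n<m → trans (singleV-off m n _ (>⇒≢ n<m)) (vΓ n n<m)) vΔ
                  (retype∧ (sym (singleV-at m _)) (derivable (d ∷ [])))
  anti-substitution s (lam t) (⇒i {U = U} D) with anti-substitution (SubstAt-underλ s) t D
  ... | unsubstituted {Γ₀} {Δ₀} d e f Tu =
    unsubstituted (subst (λ I → (λ n → Γ₀ (suc n)) ⊢⁺ lam t ∶ ((I ⇒ U) ∷ []) ∣ Δ₀) (e zero (s≤s z≤n)) (⇒i d))
                  (λ m lt → e (suc m) (s≤s lt)) f Tu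
  anti-substitution s (app t v) (⇒e* ps D E choices ne)
    with anti-substitution s t D | anti-substitution-∧ s v E
  ... | unsubstituted d e f Tu | unsubstituted d' e' f' Tu' =
    unsubstituted (⇒e* ps d d' choices ne) (≐-++ e e') (≐-++ f f') (Typable∧-++ Tu Tu')
  anti-substitution s (mu c) (#e {V = V} D choice) with anti-substitution-cmd (SubstAt-underμ s) c D
  ... | unsubstituted d e f Tu =
    unsubstituted (#e d (subst (_⋆U V) (sym (f zero (s≤s z≤n))) choice)) e
                  (λ b lt → f (suc b) (s≤s lt)) Tu

  anti-substitution-cmd : ∀ {u k j σ} → SubstAt u k j σ → ∀ c {Γ Δ} → Γ ⊢c⁺ subVc σ c ∣ Δ →
                          SubstInv (λ G D → G ⊢c⁺ c ∣ D) u k j Γ Δ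
  anti-substitution-cmd s (cmd α t) (#i {U = U} .α D) with anti-substitution s t D
  ... | unsubstituted d e f Tu =
    unsubstituted (#i α d) e (λ b lt → cong (_++ singleN α U b) (f b lt)) Tu

  anti-substitution-∧ : ∀ {u k j σ} → SubstAt u k j σ → ∀ t {Γ I Δ} → Γ ⊩⁺ subV σ t ∶ I ∣ Δ →
                        SubstInv (λ G D → G ⊩⁺ t ∶ I ∣ D) u k j Γ Δ
  anti-substitution-∧ s t [] = unsubstituted [] (λ _ _ → refl) (λ _ _ → refl) (derivable [])
  anti-substitution-∧ s t (D ∷ E) with anti-substitution s t D | anti-substitution-∧ s t E
  ... | unsubstituted d e f Tu | unsubstituted d' e' f' Tu' =
    unsubstituted (d ∷ d') (≐-++ e e') (≐-++ f f') (Typable∧-++ Tu Tu')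

record ReplProfile (u : Term) (X₀ X : Union) : Set where
  constructor profile
  field
    ps       : List (Inter × Union)
    before   : X₀ ≡ map arrow ps
    after    : X ≡ concat (map proj₂ ps)
    {Is}     : List Inter
    choices  : Pointwise _⋆I_ (map proj₁ ps) Is
    targets  : All NonEmpty (map proj₂ ps)
    argument : Typable∧ u (concat Is)

profile-[] : ∀ {u} → ReplProfile u [] []
profile-[] = profile [] refl refl [] [] (derivable [])

reprofile : ∀ {u X₀ X Y₀ Y} → X₀ ≡ Y₀ → X ≡ Y → ReplProfile u X₀ X → ReplProfile u Y₀ Y
reprofile refl refl P = P

profile-++ : ∀ {u X₀ X Y₀ Y} → ReplProfile u X₀ X → ReplProfile u Y₀ Y → ReplProfile u (X₀ ++ Y₀) (X ++ Y)
profile-++ (profile ps e₀ e₁ {Is} ch ne Tu) (profile ps' e₀' e₁' {Is'} ch' ne' Tu') =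
  profile (ps ++ ps')
    (trans (cong₂ _++_ e₀ e₀') (sym (map-++ arrow ps ps')))
    (trans (cong₂ _++_ e₁ e₁') (trans (concat-++ (map proj₂ ps) (map proj₂ ps'))
                                      (cong concat (sym (map-++ proj₂ ps ps')))))
    (subst (λ L → Pointwise _⋆I_ L (Is ++ Is')) (sym (map-++ proj₁ ps ps')) (Pointwise.++⁺ ch ch'))
    (subst (All NonEmpty) (sym (map-++ proj₂ ps ps')) (All.++⁺ ne ne'))
    (retype∧ (concat-++ Is Is') (Typable∧-++ Tu Tu'))

record ReplInv (J : VarCtx → NameCtx → Set) (u : Term) (k α : ℕ) (Γ : VarCtx) (Δ : NameCtx) : Set where
  constructor unreplaced
  field
    {Γ₀}       : VarCtx
    {Δ₀}       : NameCtx
    derivation : J Γ₀ Δ₀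
    agree-var  : Γ₀ ≐ Γ below k
    agree-nam  : Δ₀ ≐ Δ below α
    profile-α  : ReplProfile u (Δ₀ α) (Δ α)

mutual
  anti-replacement : ∀ {u k α w} → Shifted u k (suc α) w → ∀ t {Γ U Δ} → Γ ⊢⁺ repl α w t ∶ U ∣ Δ →
                     ReplInv (λ G D → G ⊢⁺ t ∶ U ∣ D) u k α Γ Δ
  anti-replacement {α = α} sh (var x) D =
    unreplaced D (λ _ _ → refl) (λ _ _ → refl) (reprofile (sym (Δ≗ α)) (sym (Δ≗ α)) profile-[])
    where Δ≗ = proj₂ (var-inversion D)
  anti-replacement sh (lam t) (⇒i {U = U} D) with anti-replacement (shiftV sh) t D
  ... | unreplaced {Γ₀} {Δ₀} d e f P =
    unreplaced (subst (λ I → (λ n → Γ₀ (suc n)) ⊢⁺ lam t ∶ ((I ⇒ U) ∷ []) ∣ Δ₀) (e zero (s≤s z≤n)) (⇒i d))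
               (λ m lt → e (suc m) (s≤s lt)) f P
  anti-replacement sh (app t v) (⇒e* ps D E choices ne)
    with anti-replacement sh t D | anti-replacement-∧ sh v E
  ... | unreplaced d e f P | unreplaced d' e' f' P' =
    unreplaced (⇒e* ps d d' choices ne) (≐-++ e e') (≐-++ f f') (profile-++ P P')
  anti-replacement sh (mu c) (#e {V = V} D choice) with anti-replacement-cmd (shiftN sh) c D
  ... | unreplaced d e f P =
    unreplaced (#e d (subst (_⋆U V) (sym (f zero (s≤s z≤n))) choice)) e
               (λ b lt → f (suc b) (s≤s lt)) P

  anti-replacement-cmd : ∀ {u k α w} → Shifted u k (suc α) w → ∀ c {Γ Δ} → Γ ⊢c⁺ replc α w c ∣ Δ →
                         ReplInv (λ G D → G ⊢c⁺ c ∣ D) u k α Γ Δ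
  anti-replacement-cmd {α = α} sh (cmd γ t) D with γ ≟ α
  anti-replacement-cmd sh (cmd γ t) (#i .γ (⇒e* ps Dt Dw choices ne)) | yes refl =
    anti-replacement-at sh t ps Dt Dw choices ne
  anti-replacement-cmd {α = α} sh (cmd γ t) (#i {U = U} .γ D) | no γ≢α with anti-replacement sh t D
  ... | unreplaced {Δ₀ = Δ₀} d e f P =
    unreplaced (#i γ d) e (λ b lt → cong (_++ singleN γ U b) (f b lt))
               (reprofile (sym (++-≡[] (Δ₀ α) (singleN-off γ α U γ≢α)))
                          (sym (++-≡[] _ (singleN-off γ α U γ≢α))) P)

  -- The occurrence [α]((t{α//u}) u): the argument u is split off into the
  -- profile, and α receives the arrow types of t.
  anti-replacement-at : ∀ {u k α w Γt Γw Δt Δw Is} → Shifted u k (suc α) w → ∀ t (ps : List (Inter × Union)) →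
                        Γt ⊢⁺ repl α w t ∶ map arrow ps ∣ Δt → Γw ⊩⁺ w ∶ concat Is ∣ Δw →
                        Pointwise _⋆I_ (map proj₁ ps) Is → All NonEmpty (map proj₂ ps) →
                        ReplInv (λ G D → G ⊢c⁺ cmd α t ∣ D) u k α
                                (Γt ∧ Γw) ((Δt ∨ Δw) ∨ singleN α (concat (map proj₂ ps)))
  anti-replacement-at {α = α} {Γt = Γt} {Γw} {Δt} {Δw} sh t ps Dt Dw choices ne
    with anti-replacement sh t Dt | shift-inversion-∧ sh Dw
  ... | unreplaced {Γ₀} {Δ₀} d e f P | unshiftedBy Tu vΓ vΔ =
    unreplaced (#i α d) agree-var agree-nam (reprofile before after (profile-++ P (profile ps refl refl choices ne Tu)))
    where
    Δw≡[] : ∀ b → b < suc α → Δw b ≡ []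
    Δw≡[] b lt = sym (vΔ b lt)
    agree-var : Γ₀ ≐ (Γt ∧ Γw) below _
    agree-var m lt = trans (e m lt) (sym (++-≡[] (Γt m) (sym (vΓ m lt))))
    agree-nam : (λ b → Δ₀ b ++ singleN α (map arrow ps) b) ≐ ((Δt ∨ Δw) ∨ singleN α (concat (map proj₂ ps))) below α
    agree-nam b lt = cong₂ _++_ (trans (f b lt) (sym (++-≡[] (Δt b) (Δw≡[] b (<-trans lt (n<1+n α))))))
                                (trans (singleN-off α b _ (>⇒≢ lt)) (sym (singleN-off α b _ (>⇒≢ lt))))
    before : Δ₀ α ++ map arrow ps ≡ Δ₀ α ++ singleN α (map arrow ps) α
    before = cong (Δ₀ α ++_) (sym (singleN-at α _))
    after : Δt α ++ concat (map proj₂ ps) ≡ (Δt α ++ Δw α) ++ singleN α (concat (map proj₂ ps)) α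
    after = cong₂ _++_ (sym (++-≡[] (Δt α) (Δw≡[] α ≤-refl))) (sym (singleN-at α _))

  anti-replacement-∧ : ∀ {u k α w} → Shifted u k (suc α) w → ∀ t {Γ I Δ} → Γ ⊩⁺ repl α w t ∶ I ∣ Δ →
                       ReplInv (λ G D → G ⊩⁺ t ∶ I ∣ D) u k α Γ Δ
  anti-replacement-∧ sh t [] = unreplaced [] (λ _ _ → refl) (λ _ _ → refl) profile-[]
  anti-replacement-∧ sh t (D ∷ E) with anti-replacement sh t D | anti-replacement-∧ sh t E
  ... | unreplaced d e f P | unreplaced d' e' f' P' =
    unreplaced (d ∷ d') (≐-++ e e') (≐-++ f f') (profile-++ P P')

data _⟶ₕ_∣_ : Term → Term → Term → Set where
  head-β   : ∀ {t u} → app (lam t) u ⟶ₕ (t [ u ]) ∣ u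
  head-μ   : ∀ {c u} → app (mu c) u ⟶ₕ mu (replc zero (renN suc u) c) ∣ u
  head-app : ∀ {t t' v u} → t ⟶ₕ t' ∣ u → app t v ⟶ₕ app t' v ∣ u

head-step : ∀ {t t' u} → t ⟶ₕ t' ∣ u → t →t t'
head-step head-β        = β
head-step head-μ        = μ
head-step (head-app hs) = appL (head-step hs)

-- Reverse a head step: the argument u of the redex must itself be typable
-- (it may be erased by the step).
subject-expansion : ∀ {t t' u Γ U Δ} → t ⟶ₕ t' ∣ u → Typed u → Γ ⊢⁺ t' ∶ U ∣ Δ → Typable t U
subject-expansion {u = u} (head-β {t}) Tu D with anti-substitution (SubstAt-top u) t D
... | unsubstituted {Γ₀} d _ _ Targ with choose-argument (Γ₀ zero) Targ Tu
... | I* , choice , Targ* = typable-app (⇒i d) (typed-nonempty D) choice Targ*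
subject-expansion {U = U} (head-μ {c}) Tu (#e D choice) with anti-replacement-cmd (shiftN unshifted) c D
-- α is erased by the step: give μα.c a blind arrow type
... | unreplaced d _ _ (profile [] before after _ _ _) with ⋆U-blind (subst (_⋆U U) after choice)
... | ξ , blind , refl with choose-argument [] (derivable []) Tu
... | I* , choice* , Targ* =
  typable-app (#e d (subst (_⋆U _) (sym before) (choose (arr blind)))) tt choice* Targ*
-- α is used: μα.c gets the arrow types of α, applied as in (⇒e*)
subject-expansion {U = U} (head-μ {c}) Tu (#e D choice)
  | unreplaced d _ _ (profile (p ∷ ps) before after choices (ne ∷ nes) (derivable E)) =
  retype (sym (trans (⋆U-keeps choice (subst NonEmpty (sym after) (++-nonempty ne))) after))
         (derivable (⇒e* (p ∷ ps) (#e d (subst (_⋆U _) (sym before) keep)) E choices (ne ∷ nes)))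
subject-expansion (head-app hs) Tu (⇒e* ps D E choices ne) with subject-expansion hs Tu D
... | derivable d = derivable (⇒e* ps d E choices ne)

data _⊒_ : Obj → Term → Set where
  root-term : ∀ {t} → term t ⊒ t
  root-cmd  : ∀ {α t} → com (cmd α t) ⊒ t
  under-lam : ∀ {o t} → o ⊒ lam t → o ⊒ t
  app-left  : ∀ {o t v} → o ⊒ app t v → o ⊒ t
  app-right : ∀ {o t v} → o ⊒ app t v → o ⊒ v
  under-mu  : ∀ {o α t} → o ⊒ mu (cmd α t) → o ⊒ t

lift-step : ∀ {o t t'} → o ⊒ t → t →t t' → Σ Obj λ o' → (o ⟶ o') × (o' ⊒ t')
lift-step root-term    st = _ , term st , root-term
lift-step root-cmd     st = _ , com (cmdC st) , root-cmd
lift-step (under-lam p) st with lift-step p (lamC st)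
... | o' , step , q = o' , step , under-lam q
lift-step (app-left p)  st with lift-step p (appL st)
... | o' , step , q = o' , step , app-left q
lift-step (app-right p) st with lift-step p (appR st)
... | o' , step , q = o' , step , app-right q
lift-step (under-mu p)  st with lift-step p (muC (cmdC st))
... | o' , step , q = o' , step , under-mu q

Flexible : Term → Set
Flexible t = ∀ U → NonEmpty U → Typable t U

flexible-app : ∀ {t v} → Flexible t → Typed v → Flexible (app t v)
flexible-app flex (V , derivable Dv) U neU with flex (((V ∷ []) ⇒ U) ∷ []) tt
... | derivable D = typable-app D neU keep (derivable (Dv ∷ []))

data HeadForm (t : Term) : Set where
  neutral : Flexible t → HeadForm t
  redex   : ∀ {t' u} → t ⟶ₕ t' ∣ u → Typed u → HeadForm t

-- μα.c is typable once c is: α's type, or a blind type if α is unused.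
typable-mu : ∀ {Γ c Δ} → Γ ⊢c⁺ c ∣ Δ → Typed (mu c)
typable-mu {Δ = Δ} D with Δ zero in eq
... | []    = _ , derivable (#e D (subst (_⋆U (base 0 ∷ [])) (sym eq) (choose base)))
... | σ ∷ L = _ , derivable (#e D (subst (_⋆U (σ ∷ L)) (sym eq) keep))

mutual
  typable-subterm : (o : Obj) → SN o → (t : Term) → o ⊒ t → Typed t
  typable-subterm o sn (var x) p = _ , derivable (ax x (base 0) [])
  typable-subterm o sn (lam t) p with typable-subterm o sn t (under-lam p)
  ... | _ , derivable D = _ , derivable (⇒i D)
  typable-subterm o sn (mu (cmd α t)) p with typable-subterm o sn t (under-mu p)
  ... | _ , derivable D = typable-mu (#i α D)
  typable-subterm o sn (app t v) p with head-form o sn t v p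
  ... | neutral flex = _ , flex (base 0 ∷ []) tt
  typable-subterm o (acc reducts) (app t v) p | redex hs Tu with lift-step p (head-step hs)
  ... | o' , step , q with typable-subterm o' (reducts step) _ q
  ... | U , derivable D = U , subject-expansion hs Tu D

  head-form : (o : Obj) → SN o → (t v : Term) → o ⊒ app t v → HeadForm (app t v)
  head-form o sn (var x) v p =
    neutral (flexible-app (λ U neU → derivable (ax⁺ x U neU)) (typable-subterm o sn v (app-right p)))
  head-form o sn (lam t) v p = redex head-β (typable-subterm o sn v (app-right p))
  head-form o sn (mu c)  v p = redex head-μ (typable-subterm o sn v (app-right p))
  head-form o sn (app t t') v p with head-form o sn t t' (app-left p)
  ... | neutral flex = neutral (flexible-app flex (typable-subterm o sn v (app-right p)))
  ... | redex hs Tu  = redex (head-app hs) Tu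

lemma6p3 : (o : Obj) → SN o → ∃ λ Γ → ∃ λ A → ∃ λ Δ → Γ ⊢o o ∶ A ∣ Δ
lemma6p3 (term t) sn with typable-subterm (term t) sn t root-term
... | _ , derivable D = _ , _ , _ , term (forget D)
lemma6p3 (com (cmd α t)) sn with typable-subterm (com (cmd α t)) sn t root-cmd
... | _ , derivable D = _ , _ , _ , com (#i α (forget D))
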